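{- Let $m,n\geq 1$ be integers and $1\leq k\leq n$. Then $$\sum_{l_{1},\dots,l_{m-1}=0}^{n}(-1)^{l_{1}+l_{2}+\cdots+l_{m-1}+k}L(n,l_{1})L(l_{1},l_{2})\cdots L(l_{m-1},k)$$ $$=\sum_{\substack{k_{1}+\cdots+k_{m}=n-k\\ k_1,\dots,k_m\geq0}}(-1)^{(n-k_{m})+(n-k_{m}-k_{m-1})+\cdots+(n-k_{m}-\cdots-k_{2})+k}\,\frac{n!}{k!}\binom{n-1}{k_{1},k_{2},\dots,k_{m},k-1}.$$
   Context: $L(n,k)$ are the Lah numbers: $L(n,k)=\binom{n-1}{k-1}\frac{n!}{k!}$ for $1\leq k\leq n$, $L(n,k)=0$ for $k>n$, $L(n,0)=0$ for $n\geq1$, and $L(0,0)=1$. For $m=1$ the left-hand side has no summation indices and is read as $(-1)^kL(n,k)$, and the exponent of $-1$ on the right-hand side reduces to $k$ (the sum $(n-k_m)+\cdots+(n-k_m-\cdots-k_2)$ has $m-1$ terms, the $j$-th being $n-k_m-k_{m-1}-\cdots-k_{m-j+1}$). The multinomial coefficient is $\binom{n-1}{k_1,\dots,k_m,k-1}=\frac{(n-1)!}{k_1!\cdots k_m!\,(k-1)!}$. -}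

module Defs where

open import Data.Nat using (ℕ; zero; suc; _+_; _*_; _∸_; _/_; _≤ᵇ_; _!)
open import Data.Nat.Properties using (_!≢0; _!*_!≢0)
open import Data.Nat.Combinatorics using (_C_)
open import Data.Bool using (if_then_else_)
open import Data.List using (List; []; _∷_; map; concatMap; upTo)
open import Data.Vec using (Vec; []; _∷_)
open import Data.Integer as ℤ using (ℤ; +_)

Lah : ℕ → ℕ → ℕ
Lah zero    zero    = 1
Lah zero    (suc k) = 0
Lah (suc n) zero    = 0
Lah (suc n) (suc k) =
  if suc k ≤ᵇ suc n then (n C k) * ((suc n) ! / (suc k) !) else 0
  where instance _ = (suc k) !≢0

sgn : ℕ → ℤ
sgn e = (ℤ.- (+ 1)) ℤ.^ e

sumℤ : List ℤ → ℤ
sumℤ []       = + 0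
sumℤ (x ∷ xs) = x ℤ.+ sumℤ xs

sumℕ : {j : ℕ} → Vec ℕ j → ℕ
sumℕ []       = 0
sumℕ (x ∷ xs) = x + sumℕ xs

tuples : (j n : ℕ) → List (Vec ℕ j)
tuples zero    n = [] ∷ []
tuples (suc j) n = concatMap (λ l → map (l ∷_) (tuples j n)) (upTo (suc n))

chainProd : {j : ℕ} → ℕ → Vec ℕ j → ℕ → ℕ
chainProd a []       k = Lah a k
chainProd a (l ∷ ls) k = Lah a l * chainProd l ls k

compositions : (m s : ℕ) → List (Vec ℕ m)
compositions zero    zero    = [] ∷ []
compositions zero    (suc s) = []
compositions (suc m) s =
  concatMap (λ a → map (a ∷_) (compositions m (s ∸ a))) (upTo (suc s))

suffixExp : {r : ℕ} → ℕ → Vec ℕ r → ℕ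
suffixExp n []       = 0
suffixExp n (y ∷ ys) = (n ∸ sumℕ (y ∷ ys)) + suffixExp n ys

-- for (k₁,…,k_m): (n-k_m) + (n-k_m-k_{m-1}) + ⋯ + (n-k_m-⋯-k₂)
-- (m-1 terms; 0 when m = 1 or m = 0)
compExp : {m : ℕ} → ℕ → Vec ℕ m → ℕ
compExp n []       = 0
compExp n (_ ∷ ks) = suffixExp n ks

factProd : {m : ℕ} → Vec ℕ m → ℕ
factProd []       = 1
factProd (x ∷ xs) = x ! * factProd xs

factProd≢0 : {m : ℕ} (v : Vec ℕ m) → Data.Nat.NonZero (factProd v)
factProd≢0 []       = _
factProd≢0 (x ∷ xs) = Data.Nat.Properties.m*n≢0 (x !) (factProd xs) {{x !≢0}} {{factProd≢0 xs}}

multinomial : {m : ℕ} → ℕ → Vec ℕ m → ℕ → ℕ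
multinomial n ks k = (n ∸ 1) ! / (factProd ks * (k ∸ 1) !)
  where instance _ = Data.Nat.Properties.m*n≢0 (factProd ks) ((k ∸ 1) !) {{factProd≢0 ks}} {{(k ∸ 1) !≢0}}

lhs : (m n k : ℕ) → ℤ
lhs m n k = sumℤ (map (λ ls → sgn (sumℕ ls + k) ℤ.* + chainProd n ls k) (tuples (m ∸ 1) n))

rhs : (m n k : ℕ) → ℤ
rhs m n k = sumℤ (map (λ ks → sgn (compExp n ks + k) ℤ.* + ((n ! / k !) * multinomial n ks k))
                      (compositions m (n ∸ k)))
  where instance _ = k !≢0

{-# OPTIONS --safe #-}
-- Let S(n,k) = (-1)^k L(n,k) be the signed Lah matrix. The left-hand side is the (n,k) entry of the
-- matrix power S^m, and S is an involution (the inversion relation of the Lah numbers, which follows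
-- from their two-term recurrence), so it equals S(n,k) for odd m and δ(n,k) for even m.
-- On the right, the multinomial coefficient factors as C(n-1,k-1) times the multinomial coefficient
-- of the composition (k₁,…,k_m) of s = n-k, so the right-hand side is S(n,k) times a signed sum
-- over compositions of s into m parts. Splitting off the first part turns that sum into an alternating
-- binomial transform of the sum with m-1 parts; since Σ_a (-1)^a C(s,a) = [s = 0], it is 1 for odd m
-- and (-1)^n [s = 0] for even m, which matches S^m entry by entry.
module Submission where

open import Data.Empty using (⊥-elim)
open import Data.List using (List; []; _∷_; _++_; map; concatMap; applyUpTo; upTo)
import Data.List.Properties as List
open import Data.Nat as ℕ using (ℕ; zero; suc; _≤_; _<_; z≤n; s≤s; _≤?_; _!; _∸_)
import Data.Nat.Properties as ℕₚ
open import Data.Nat.Properties using (_!≢0)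
open import Data.Nat.Combinatorics using (_C_; nCk+nC[k+1]≡[n+1]C[k+1]; nC1≡n; nCn≡1; k>n⇒nCk≡0)
import Data.Integer.Properties as ℤₚ
open import Data.Vec using (Vec; []; _∷_)
open import Function using (_∘_)
open import Relation.Binary.PropositionalEquality
open import Relation.Nullary using (yes; no)

open import Defs

-- It agrees with the closed form because
-- both satisfy L(n+1,k+1) (k+1)! = C(n,k) (n+1)!, in which the division of the closed form cancels.
module LahRecurrence where

  open import Data.Bool using (true; false; T)
  open import Data.Nat using (_+_; _*_; _/_; _≤ᵇ_)
  open import Data.Nat.Divisibility using (m≤n⇒m!∣n!)
  open import Data.Nat.DivMod using (m/n*n≡m)
  open import Data.Nat.Tactic.RingSolver using (solve-∀)
  open import Data.Unit using (tt)

  private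

    Lah′ : ℕ → ℕ → ℕ
    Lah′ zero    zero    = 1
    Lah′ zero    (suc k) = 0
    Lah′ (suc n) zero    = 0
    Lah′ (suc n) (suc k) = (n + suc k) * Lah′ n (suc k) + Lah′ n k

    Lah′-above : ∀ {n k} → n < k → Lah′ n k ≡ 0
    Lah′-above {zero}  {suc k} _         = refl
    Lah′-above {suc n} {suc k} (s≤s n<k) = begin
      (n + suc k) * Lah′ n (suc k) + Lah′ n k ≡⟨ cong₂ (λ x y → (n + suc k) * x + y)
                                                       (Lah′-above (ℕₚ.m<n⇒m<1+n n<k)) (Lah′-above n<k) ⟩
      (n + suc k) * 0 + 0                     ≡⟨ cong (_+ 0) (ℕₚ.*-zeroʳ (n + suc k)) ⟩
      0                                       ∎
      where open ≡-Reasoning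

    [k+1]*[n+1]C[k+1]≡[n+1]*nCk : ∀ n k → suc k * (suc n C suc k) ≡ suc n * (n C k)
    [k+1]*[n+1]C[k+1]≡[n+1]*nCk zero    zero    = refl
    [k+1]*[n+1]C[k+1]≡[n+1]*nCk zero    (suc k) = ℕₚ.*-zeroʳ (suc (suc k))
    [k+1]*[n+1]C[k+1]≡[n+1]*nCk (suc m) zero    = trans (ℕₚ.*-identityˡ _)
      (trans (nC1≡n (suc (suc m))) (sym (ℕₚ.*-identityʳ _)))
    [k+1]*[n+1]C[k+1]≡[n+1]*nCk (suc m) (suc i) = begin
      suc (suc i) * (suc (suc m) C suc (suc i))
        ≡⟨ cong (suc (suc i) *_) (sym (nCk+nC[k+1]≡[n+1]C[k+1] (suc m) (suc i))) ⟩
      suc (suc i) * (c + c′)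
        ≡⟨ split i c c′ ⟩
      (suc i * c + c) + suc (suc i) * c′
        ≡⟨ cong₂ (λ x y → (x + c) + y) ([k+1]*[n+1]C[k+1]≡[n+1]*nCk m i)
                                        ([k+1]*[n+1]C[k+1]≡[n+1]*nCk m (suc i)) ⟩
      (suc m * (m C i) + c) + suc m * (m C suc i)
        ≡⟨ regroup m (m C i) (m C suc i) c ⟩
      suc m * ((m C i) + (m C suc i)) + c
        ≡⟨ cong (λ x → suc m * x + c) (nCk+nC[k+1]≡[n+1]C[k+1] m i) ⟩
      suc m * c + c
        ≡⟨ ℕₚ.+-comm (suc m * c) c ⟩
      suc (suc m) * c ∎
      where
      open ≡-Reasoning
      c c′ : ℕ
      c  = suc m C suc i
      c′ = suc m C suc (suc i)
      split : ∀ i c c′ → suc (suc i) * (c + c′) ≡ (suc i * c + c) + suc (suc i) * c′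
      split = solve-∀
      regroup : ∀ m x y c → (suc m * x + c) + suc m * y ≡ suc m * (x + y) + c
      regroup = solve-∀

    Lah′*[k+1]!≡nCk*[n+1]! : ∀ n k → Lah′ (suc n) (suc k) * suc k ! ≡ (n C k) * suc n !
    Lah′*[k+1]!≡nCk*[n+1]! zero    zero    = refl
    Lah′*[k+1]!≡nCk*[n+1]! zero    (suc k) = cong (_* suc (suc k) !) (Lah′-above {1} {suc (suc k)} (s≤s (s≤s z≤n)))
    Lah′*[k+1]!≡nCk*[n+1]! (suc m) zero    = begin
      ((suc m + 1) * Lah′ (suc m) 1 + 0) * 1 ≡⟨ pull m (Lah′ (suc m) 1) ⟩
      suc (suc m) * (Lah′ (suc m) 1 * 1)     ≡⟨ cong (suc (suc m) *_) (Lah′*[k+1]!≡nCk*[n+1]! m zero) ⟩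
      suc (suc m) * (1 * suc m !)            ≡⟨ push m (suc m !) ⟩
      1 * suc (suc m) !                      ∎
      where
      open ≡-Reasoning
      pull : ∀ m x → ((suc m + 1) * x + 0) * 1 ≡ suc (suc m) * (x * 1)
      pull = solve-∀
      push : ∀ m f → suc (suc m) * (1 * f) ≡ 1 * (suc (suc m) * f)
      push = solve-∀
    Lah′*[k+1]!≡nCk*[n+1]! (suc m) (suc i) = begin
      ((suc m + suc (suc i)) * a + b) * (suc (suc i) * suc i !)
        ≡⟨ expand m i a b (suc i !) ⟩
      (suc m + suc (suc i)) * (a * suc (suc i) !) + suc (suc i) * (b * suc i !)
        ≡⟨ cong₂ (λ x y → (suc m + suc (suc i)) * x + suc (suc i) * y)
                 (Lah′*[k+1]!≡nCk*[n+1]! m (suc i)) (Lah′*[k+1]!≡nCk*[n+1]! m i) ⟩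
      (suc m + suc (suc i)) * (c₁ * f) + suc (suc i) * (c₀ * f)
        ≡⟨ regroup m i c₀ c₁ f ⟩
      (suc (suc m) * c₁ + suc i * (c₀ + c₁) + c₀) * f
        ≡⟨ cong (λ x → (suc (suc m) * c₁ + suc i * x + c₀) * f) (nCk+nC[k+1]≡[n+1]C[k+1] m i) ⟩
      (suc (suc m) * c₁ + suc i * (suc m C suc i) + c₀) * f
        ≡⟨ cong (λ x → (suc (suc m) * c₁ + x + c₀) * f) ([k+1]*[n+1]C[k+1]≡[n+1]*nCk m i) ⟩
      (suc (suc m) * c₁ + suc m * c₀ + c₀) * f
        ≡⟨ collect m c₀ c₁ f ⟩
      (c₀ + c₁) * suc (suc m) !
        ≡⟨ cong (_* suc (suc m) !) (nCk+nC[k+1]≡[n+1]C[k+1] m i) ⟩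
      (suc m C suc i) * suc (suc m) ! ∎
      where
      open ≡-Reasoning
      a b c₀ c₁ f : ℕ
      a  = Lah′ (suc m) (suc (suc i))
      b  = Lah′ (suc m) (suc i)
      c₀ = m C i
      c₁ = m C suc i
      f  = suc m !
      expand : ∀ m i a b g → ((suc m + suc (suc i)) * a + b) * (suc (suc i) * g)
                           ≡ (suc m + suc (suc i)) * (a * (suc (suc i) * g)) + suc (suc i) * (b * g)
      expand = solve-∀
      regroup : ∀ m i c₀ c₁ f → (suc m + suc (suc i)) * (c₁ * f) + suc (suc i) * (c₀ * f)
                              ≡ (suc (suc m) * c₁ + suc i * (c₀ + c₁) + c₀) * f
      regroup = solve-∀
      collect : ∀ m c₀ c₁ f → (suc (suc m) * c₁ + suc m * c₀ + c₀) * f ≡ (c₀ + c₁) * (suc (suc m) * f)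
      collect = solve-∀

    Lah*[k+1]!≡nCk*[n+1]! : ∀ n k → Lah (suc n) (suc k) * suc k ! ≡ (n C k) * suc n !
    Lah*[k+1]!≡nCk*[n+1]! n k with suc k ≤ᵇ suc n in eq
    ... | true  = trans (ℕₚ.*-assoc (n C k) _ _)
                        (cong ((n C k) *_) (m/n*n≡m {{suc k !≢0}} (m≤n⇒m!∣n! (ℕₚ.≤ᵇ⇒≤ (suc k) (suc n) (subst T (sym eq) tt)))))
    ... | false = cong (_* suc n !) (sym (k>n⇒nCk≡0 {n} {k} (ℕₚ.≰⇒> λ k≤n → subst T eq (ℕₚ.≤⇒≤ᵇ (s≤s k≤n)))))

    Lah≡Lah′ : ∀ n k → Lah n k ≡ Lah′ n k
    Lah≡Lah′ zero    zero    = refl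
    Lah≡Lah′ zero    (suc k) = refl
    Lah≡Lah′ (suc n) zero    = refl
    Lah≡Lah′ (suc n) (suc k) = ℕₚ.*-cancelʳ-≡ _ _ (suc k !) {{suc k !≢0}}
      (trans (Lah*[k+1]!≡nCk*[n+1]! n k) (sym (Lah′*[k+1]!≡nCk*[n+1]! n k)))

  Lah-suc-suc : ∀ n k → Lah (suc n) (suc k) ≡ (n + suc k) * Lah n (suc k) + Lah n k
  Lah-suc-suc n k = begin
    Lah (suc n) (suc k)                      ≡⟨ Lah≡Lah′ (suc n) (suc k) ⟩
    (n + suc k) * Lah′ n (suc k) + Lah′ n k  ≡⟨ cong₂ (λ x y → (n + suc k) * x + y)
                                                      (sym (Lah≡Lah′ n (suc k))) (sym (Lah≡Lah′ n k)) ⟩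
    (n + suc k) * Lah n (suc k) + Lah n k    ∎
    where open ≡-Reasoning

  Lah-above : ∀ {n k} → n < k → Lah n k ≡ 0
  Lah-above {n} {k} n<k = trans (Lah≡Lah′ n k) (Lah′-above n<k)

  Lah≡nCk*[n+1]!/[k+1]! : ∀ {n k} → k ≤ n → Lah (suc n) (suc k) ≡ (n C k) * (suc n ! / suc k !) {{suc k !≢0}}
  Lah≡nCk*[n+1]!/[k+1]! {n} {k} k≤n with suc k ≤ᵇ suc n in eq
  ... | true  = refl
  ... | false = ⊥-elim (subst T eq (ℕₚ.≤⇒≤ᵇ (s≤s k≤n)))

  Lah-diag : ∀ n → Lah n n ≡ 1
  Lah-diag zero    = refl
  Lah-diag (suc n) = begin
    Lah (suc n) (suc n)                   ≡⟨ Lah-suc-suc n n ⟩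
    (n + suc n) * Lah n (suc n) + Lah n n ≡⟨ cong₂ (λ x y → (n + suc n) * x + y) (Lah-above (ℕₚ.n<1+n n)) (Lah-diag n) ⟩
    (n + suc n) * 0 + 1                   ≡⟨ cong (_+ 1) (ℕₚ.*-zeroʳ (n + suc n)) ⟩
    1                                     ∎
    where open ≡-Reasoning

open LahRecurrence

module MultinomialCoefficients where

  open import Data.Nat using (_+_; _*_)
  open import Data.Nat.Combinatorics using (nCk≡n!/k![n-k]!; k![n∸k]!∣n!)
  open import Data.Nat.DivMod using (m/n*n≡m; m*n/n≡m; /-congˡ)
  open import Data.Nat.Properties using (_!*_!≢0)
  open import Data.Nat.Tactic.RingSolver using (solve-∀)

  multinomialC : ∀ {m} → Vec ℕ m → ℕ
  multinomialC []       = 1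
  multinomialC (a ∷ ks) = ((a + sumℕ ks) C a) * multinomialC ks

  nCk*[k!*[n∸k]!]≡n! : ∀ {n k} → k ≤ n → (n C k) * (k ! * (n ∸ k) !) ≡ n !
  nCk*[k!*[n∸k]!]≡n! {n} {k} k≤n = trans (cong (_* (k ! * (n ∸ k) !)) (nCk≡n!/k![n-k]! k≤n))
                                         (m/n*n≡m {{k !* (n ∸ k) !≢0}} (k![n∸k]!∣n! k≤n))

  multinomialC*factProd≡sum! : ∀ {m} (ks : Vec ℕ m) → multinomialC ks * factProd ks ≡ sumℕ ks !
  multinomialC*factProd≡sum! []       = refl
  multinomialC*factProd≡sum! (a ∷ ks) = begin
    (((a + b) C a) * multinomialC ks) * (a ! * factProd ks)
      ≡⟨ shuffle ((a + b) C a) (multinomialC ks) (a !) (factProd ks) ⟩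
    ((a + b) C a) * (a ! * (multinomialC ks * factProd ks))
      ≡⟨ cong (λ x → ((a + b) C a) * (a ! * x)) (multinomialC*factProd≡sum! ks) ⟩
    ((a + b) C a) * (a ! * b !)
      ≡⟨ cong (λ x → ((a + b) C a) * (a ! * x !)) (sym (ℕₚ.m+n∸m≡n a b)) ⟩
    ((a + b) C a) * (a ! * ((a + b) ∸ a) !)
      ≡⟨ nCk*[k!*[n∸k]!]≡n! (ℕₚ.m≤m+n a b) ⟩
    (a + b) ! ∎
    where
    open ≡-Reasoning
    b : ℕ
    b = sumℕ ks
    shuffle : ∀ c m x f → (c * m) * (x * f) ≡ c * (x * (m * f))
    shuffle = solve-∀

  multinomial≡nCk*multinomialC : ∀ {m} n k (ks : Vec ℕ m) → k ≤ n → sumℕ ks ≡ n ∸ k →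
                                 multinomial (suc n) ks (suc k) ≡ (n C k) * multinomialC ks
  multinomial≡nCk*multinomialC n k ks k≤n Σks≡n∸k =
    trans (/-congˡ n!≡) (m*n/n≡m ((n C k) * multinomialC ks) (factProd ks * k !))
    where
    instance
      _ = ℕₚ.m*n≢0 (factProd ks) (k !) {{factProd≢0 ks}} {{k !≢0}}
    shuffle : ∀ c f x m → c * (x * (m * f)) ≡ (c * m) * (f * x)
    shuffle = solve-∀
    n!≡ : n ! ≡ ((n C k) * multinomialC ks) * (factProd ks * k !)
    n!≡ = begin
      n !                                                ≡⟨ nCk*[k!*[n∸k]!]≡n! k≤n ⟨
      (n C k) * (k ! * (n ∸ k) !)                        ≡⟨ cong (λ t → (n C k) * (k ! * t !)) Σks≡n∸k ⟨
      (n C k) * (k ! * sumℕ ks !)                        ≡⟨ cong (λ t → (n C k) * (k ! * t)) (multinomialC*factProd≡sum! ks) ⟨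
      (n C k) * (k ! * (multinomialC ks * factProd ks))  ≡⟨ shuffle (n C k) (factProd ks) (k !) (multinomialC ks) ⟩
      ((n C k) * multinomialC ks) * (factProd ks * k !)  ∎
      where open ≡-Reasoning

open MultinomialCoefficients

open import Data.Integer using (ℤ; +_; _+_; _*_; -_; _-_)
open import Data.Integer.Tactic.RingSolver using (solve-∀)

∑< : ℕ → (ℕ → ℤ) → ℤ
∑< zero    f = + 0
∑< (suc n) f = f 0 + ∑< n (f ∘ suc)

syntax ∑< n (λ i → f) = ∑[ i < n ] f

∑-cong : ∀ n {f g : ℕ → ℤ} → (∀ i → i < n → f i ≡ g i) → ∑< n f ≡ ∑< n g
∑-cong zero    eq = refl
∑-cong (suc n) eq = cong₂ _+_ (eq 0 (s≤s z≤n)) (∑-cong n (λ i i<n → eq (suc i) (s≤s i<n)))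

∑-+ : ∀ n (f g : ℕ → ℤ) → ∑[ i < n ] (f i + g i) ≡ ∑< n f + ∑< n g
∑-+ zero    f g = refl
∑-+ (suc n) f g = trans (cong (_+_ (f 0 + g 0)) (∑-+ n (f ∘ suc) (g ∘ suc))) (middleFour (f 0) (g 0) _ _)
  where
  middleFour : ∀ a b c d → (a + b) + (c + d) ≡ (a + c) + (b + d)
  middleFour = solve-∀

∑-*ˡ : ∀ n c (f : ℕ → ℤ) → ∑[ i < n ] (c * f i) ≡ c * ∑< n f
∑-*ˡ zero    c f = sym (ℤₚ.*-zeroʳ c)
∑-*ˡ (suc n) c f = trans (cong (_+_ (c * f 0)) (∑-*ˡ n c (f ∘ suc))) (sym (ℤₚ.*-distribˡ-+ c (f 0) _))

∑-last : ∀ n (f : ℕ → ℤ) → ∑< (suc n) f ≡ ∑< n f + f n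
∑-last zero    f = trans (ℤₚ.+-identityʳ (f 0)) (sym (ℤₚ.+-identityˡ (f 0)))
∑-last (suc n) f = trans (cong (_+_ (f 0)) (∑-last n (f ∘ suc))) (sym (ℤₚ.+-assoc (f 0) _ _))

∑-zero : ∀ n (f : ℕ → ℤ) → (∀ i → i < n → f i ≡ + 0) → ∑< n f ≡ + 0
∑-zero zero    f z = refl
∑-zero (suc n) f z = cong₂ _+_ (z 0 (s≤s z≤n)) (∑-zero n (f ∘ suc) (λ i i<n → z (suc i) (s≤s i<n)))

∑-truncate : ∀ {m n} (f : ℕ → ℤ) → m ≤ n → (∀ i → m ≤ i → i < n → f i ≡ + 0) → ∑< n f ≡ ∑< m f
∑-truncate {n = n} f z≤n       z = ∑-zero n f (λ i → z i z≤n)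
∑-truncate         f (s≤s m≤n) z =
  cong (_+_ (f 0)) (∑-truncate (f ∘ suc) m≤n (λ i m≤i i<n → z (suc i) (s≤s m≤i) (s≤s i<n)))

∑-single : ∀ {n} j (f : ℕ → ℤ) → j < n → (∀ i → i < n → i ≢ j → f i ≡ + 0) → ∑< n f ≡ f j
∑-single {suc n} zero    f _         z =
  trans (cong (_+_ (f 0)) (∑-zero n (f ∘ suc) (λ i i<n → z (suc i) (s≤s i<n) λ ()))) (ℤₚ.+-identityʳ (f 0))
∑-single {suc n} (suc j) f (s≤s j<n) z =
  trans (cong (_+ ∑< n (f ∘ suc)) (z 0 (s≤s z≤n) λ ())) (trans (ℤₚ.+-identityˡ _)
        (∑-single j (f ∘ suc) j<n (λ i i<n i≢j → z (suc i) (s≤s i<n) (i≢j ∘ ℕₚ.suc-injective))))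

sumℤ-++ : ∀ xs ys → sumℤ (xs ++ ys) ≡ sumℤ xs + sumℤ ys
sumℤ-++ []       ys = sym (ℤₚ.+-identityˡ _)
sumℤ-++ (x ∷ xs) ys = trans (cong (_+_ x) (sumℤ-++ xs ys)) (sym (ℤₚ.+-assoc x _ _))

sumℤ-map-concatMap : ∀ {A B : Set} (g : B → ℤ) (h : A → List B) xs →
  sumℤ (map g (concatMap h xs)) ≡ sumℤ (map (λ x → sumℤ (map g (h x))) xs)
sumℤ-map-concatMap g h []       = refl
sumℤ-map-concatMap g h (x ∷ xs) = begin
  sumℤ (map g (h x ++ concatMap h xs))
    ≡⟨ cong sumℤ (List.map-++ g (h x) (concatMap h xs)) ⟩
  sumℤ (map g (h x) ++ map g (concatMap h xs))
    ≡⟨ sumℤ-++ (map g (h x)) (map g (concatMap h xs)) ⟩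
  sumℤ (map g (h x)) + sumℤ (map g (concatMap h xs))
    ≡⟨ cong (_+_ (sumℤ (map g (h x)))) (sumℤ-map-concatMap g h xs) ⟩
  sumℤ (map g (h x)) + sumℤ (map (λ y → sumℤ (map g (h y))) xs) ∎
  where open ≡-Reasoning

sumℤ-map-*ˡ : ∀ {A : Set} c (g : A → ℤ) xs → sumℤ (map (λ x → c * g x) xs) ≡ c * sumℤ (map g xs)
sumℤ-map-*ˡ c g []       = sym (ℤₚ.*-zeroʳ c)
sumℤ-map-*ˡ c g (x ∷ xs) = trans (cong (_+_ (c * g x)) (sumℤ-map-*ˡ c g xs)) (sym (ℤₚ.*-distribˡ-+ c _ _))

sumℤ-map-applyUpTo : ∀ n (g : ℕ → ℤ) (h : ℕ → ℕ) → sumℤ (map g (applyUpTo h n)) ≡ ∑< n (g ∘ h)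
sumℤ-map-applyUpTo zero    g h = refl
sumℤ-map-applyUpTo (suc n) g h = cong (_+_ (g (h 0))) (sumℤ-map-applyUpTo n g (h ∘ suc))

sumℤ-map-concatMap-upTo : ∀ {j : ℕ} n (g : Vec ℕ (suc j) → ℤ) (xs : ℕ → List (Vec ℕ j)) →
  sumℤ (map g (concatMap (λ l → map (l ∷_) (xs l)) (upTo n)))
    ≡ ∑[ l < n ] sumℤ (map (λ v → g (l ∷ v)) (xs l))
sumℤ-map-concatMap-upTo n g xs = begin
  sumℤ (map g (concatMap (λ l → map (l ∷_) (xs l)) (upTo n)))
    ≡⟨ sumℤ-map-concatMap g _ (upTo n) ⟩
  sumℤ (map (λ l → sumℤ (map g (map (l ∷_) (xs l)))) (upTo n))
    ≡⟨ sumℤ-map-applyUpTo n _ (λ l → l) ⟩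
  ∑[ l < n ] sumℤ (map g (map (l ∷_) (xs l)))
    ≡⟨ ∑-cong n (λ l _ → cong sumℤ (sym (List.map-∘ (xs l)))) ⟩
  ∑[ l < n ] sumℤ (map (λ v → g (l ∷ v)) (xs l)) ∎
  where open ≡-Reasoning

sgn-+ : ∀ a b → sgn (a ℕ.+ b) ≡ sgn a * sgn b
sgn-+ = ℤₚ.^-distribˡ-+-* (- + 1)

sgn-suc : ∀ a → sgn (suc a) ≡ - sgn a
sgn-suc a = ℤₚ.-1*i≡-i (sgn a)

sgn*sgn≡1 : ∀ a → sgn a * sgn a ≡ + 1
sgn*sgn≡1 zero    = refl
sgn*sgn≡1 (suc a) = trans (negSquare (sgn a)) (sgn*sgn≡1 a)
  where
  negSquare : ∀ s → (- + 1 * s) * (- + 1 * s) ≡ s * s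
  negSquare = solve-∀

sgn-∸ : ∀ {n t} → t ≤ n → sgn (n ∸ t) ≡ sgn n * sgn t
sgn-∸ {n} {t} t≤n = sym (begin
  sgn n * sgn t                 ≡⟨ cong (λ x → sgn x * sgn t) (sym (ℕₚ.m∸n+n≡m t≤n)) ⟩
  sgn (n ∸ t ℕ.+ t) * sgn t     ≡⟨ cong (_* sgn t) (sgn-+ (n ∸ t) t) ⟩
  sgn (n ∸ t) * sgn t * sgn t   ≡⟨ ℤₚ.*-assoc (sgn (n ∸ t)) (sgn t) (sgn t) ⟩
  sgn (n ∸ t) * (sgn t * sgn t) ≡⟨ cong (sgn (n ∸ t) *_) (sgn*sgn≡1 t) ⟩
  sgn (n ∸ t) * + 1             ≡⟨ ℤₚ.*-identityʳ (sgn (n ∸ t)) ⟩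
  sgn (n ∸ t)                   ∎)
  where open ≡-Reasoning

δ : ℕ → ℕ → ℤ
δ zero    zero    = + 1
δ zero    (suc _) = + 0
δ (suc _) zero    = + 0
δ (suc a) (suc b) = δ a b

δ-refl : ∀ a → δ a a ≡ + 1
δ-refl zero    = refl
δ-refl (suc a) = δ-refl a

δ-≢ : ∀ {a b} → a ≢ b → δ a b ≡ + 0
δ-≢ {zero}  {zero}  a≢b = ⊥-elim (a≢b refl)
δ-≢ {zero}  {suc b} a≢b = refl
δ-≢ {suc a} {zero}  a≢b = refl
δ-≢ {suc a} {suc b} a≢b = δ-≢ (a≢b ∘ cong suc)

[a-b]*δ≡0 : ∀ a b → (+ a - + b) * δ a b ≡ + 0
[a-b]*δ≡0 zero    zero    = refl
[a-b]*δ≡0 zero    (suc b) = ℤₚ.*-zeroʳ (+ 0 - + suc b)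
[a-b]*δ≡0 (suc a) zero    = ℤₚ.*-zeroʳ (+ suc a - + 0)
[a-b]*δ≡0 (suc a) (suc b) = trans (cong (_* δ a b) (shift a b)) ([a-b]*δ≡0 a b)
  where
  shift : ∀ a b → + suc a - + suc b ≡ + a - + b
  shift a b = trans (cong₂ _-_ (ℤₚ.pos-+ 1 a) (ℤₚ.pos-+ 1 b)) (cancel (+ a) (+ b))
    where
    cancel : ∀ x y → (+ 1 + x) - (+ 1 + y) ≡ x - y
    cancel = solve-∀

sgn*δ-0 : ∀ s → sgn s * δ s 0 ≡ δ s 0
sgn*δ-0 zero    = refl
sgn*δ-0 (suc s) = ℤₚ.*-zeroʳ (sgn (suc s))

δ[n∸k,0]≡0 : ∀ {n k} → k ≤ n → k ≢ n → δ (n ∸ k) 0 ≡ + 0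
δ[n∸k,0]≡0 k≤n k≢n = δ-≢ λ n∸k≡0 → k≢n (ℕₚ.≤-antisym k≤n (ℕₚ.m∸n≡0⇒m≤n n∸k≡0))

L : ℕ → ℕ → ℤ
L n k = + Lah n k

S : ℕ → ℕ → ℤ
S n k = sgn k * L n k

L-suc-suc : ∀ n k → L (suc n) (suc k) ≡ (+ n + + suc k) * L n (suc k) + L n k
L-suc-suc n k = begin
  + Lah (suc n) (suc k)                                   ≡⟨ cong +_ (Lah-suc-suc n k) ⟩
  + ((n ℕ.+ suc k) ℕ.* Lah n (suc k) ℕ.+ Lah n k)         ≡⟨ ℤₚ.pos-+ _ (Lah n k) ⟩
  + ((n ℕ.+ suc k) ℕ.* Lah n (suc k)) + L n k             ≡⟨ cong (_+ L n k) (ℤₚ.pos-* (n ℕ.+ suc k) _) ⟩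
  + (n ℕ.+ suc k) * L n (suc k) + L n k                   ≡⟨ cong (λ x → x * L n (suc k) + L n k) (ℤₚ.pos-+ n (suc k)) ⟩
  (+ n + + suc k) * L n (suc k) + L n k                   ∎
  where open ≡-Reasoning

L-above : ∀ {n k} → n < k → L n k ≡ + 0
L-above n<k = cong +_ (Lah-above n<k)

[n+0]*L[n,0]≡0 : ∀ n → (+ n + + 0) * L n 0 ≡ + 0
[n+0]*L[n,0]≡0 zero    = refl
[n+0]*L[n,0]≡0 (suc n) = ℤₚ.*-zeroʳ (+ suc n + + 0)

alternatingLahSum : ℕ → ℕ → ℤ
alternatingLahSum n k = ∑[ l < suc n ] (sgn l * (L n l * L l k))

-- The recurrence of L in the row index, followed by the shift l ↦ l + 1 in its second term.
alternatingLahSum-suc : ∀ n k → alternatingLahSum (suc n) k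
  ≡ ∑[ l < suc n ] (sgn l * ((+ n + + l) * L n l * L l k) - sgn l * (L n l * L (suc l) k))
alternatingLahSum-suc n k = begin
  f 0 + ∑[ l < suc n ] f (suc l)               ≡⟨⟩
  + 0 + ∑[ l < suc n ] f (suc l)               ≡⟨ ℤₚ.+-identityˡ _ ⟩
  ∑[ l < suc n ] f (suc l)                     ≡⟨ ∑-cong (suc n) (λ l _ → f-suc l) ⟩
  ∑[ l < suc n ] (h (suc l) + - g l)           ≡⟨ ∑-+ (suc n) (h ∘ suc) (-_ ∘ g) ⟩
  ∑< (suc n) (h ∘ suc) + ∑[ l < suc n ] (- g l) ≡⟨ cong (_+ ∑[ l < suc n ] (- g l)) shift ⟩
  ∑< (suc n) h + ∑[ l < suc n ] (- g l)         ≡⟨ ∑-+ (suc n) h (-_ ∘ g) ⟨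
  ∑[ l < suc n ] (h l - g l)                   ∎
  where
  open ≡-Reasoning
  f h g : ℕ → ℤ
  f l = sgn l * (L (suc n) l * L l k)
  h l = sgn l * ((+ n + + l) * L n l * L l k)
  g l = sgn l * (L n l * L (suc l) k)
  f-suc : ∀ l → f (suc l) ≡ h (suc l) + - g l
  f-suc l = begin
    sgn (suc l) * (L (suc n) (suc l) * L (suc l) k)
      ≡⟨ cong₂ (λ s x → s * (x * L (suc l) k)) (sgn-suc l) (L-suc-suc n l) ⟩
    - sgn l * (((+ n + + suc l) * L n (suc l) + L n l) * L (suc l) k)
      ≡⟨ distrib (sgn l) (+ n + + suc l) (L n (suc l)) (L n l) (L (suc l) k) ⟩
    - sgn l * ((+ n + + suc l) * L n (suc l) * L (suc l) k) + - g l
      ≡⟨ cong (λ s → s * ((+ n + + suc l) * L n (suc l) * L (suc l) k) + - g l) (sgn-suc l) ⟨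
    h (suc l) + - g l ∎
    where
    distrib : ∀ s p x y z → - s * ((p * x + y) * z) ≡ - s * (p * x * z) + - (s * (y * z))
    distrib = solve-∀
  h-above : ∀ l → n < l → h l ≡ + 0
  h-above l n<l = trans (cong (λ x → sgn l * ((+ n + + l) * x * L l k)) (L-above n<l))
                        (vanish (sgn l) (+ n + + l) (L l k))
    where
    vanish : ∀ s p z → s * (p * + 0 * z) ≡ + 0
    vanish = solve-∀
  h-zero : h 0 ≡ + 0
  h-zero = cong (λ x → + 1 * (x * L 0 k)) ([n+0]*L[n,0]≡0 n)
  shift : ∑< (suc n) (h ∘ suc) ≡ ∑< (suc n) h
  shift = begin
    ∑< (suc n) (h ∘ suc)       ≡⟨ ∑-truncate (h ∘ suc) (ℕₚ.n≤1+n n) (λ i n≤i _ → h-above (suc i) (s≤s n≤i)) ⟩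
    ∑< n (h ∘ suc)             ≡⟨ ℤₚ.+-identityˡ _ ⟨
    + 0 + ∑< n (h ∘ suc)       ≡⟨ cong (_+ ∑< n (h ∘ suc)) h-zero ⟨
    ∑< (suc n) h               ∎

alternatingLahSum-suc-zero : ∀ n → alternatingLahSum (suc n) 0 ≡ + 0
alternatingLahSum-suc-zero n = trans (alternatingLahSum-suc n 0) (∑-zero (suc n) _ vanish)
  where
  zeroes : ∀ s x y → s * (x * + 0) - s * (y * + 0) ≡ + 0
  zeroes = solve-∀
  vanish : ∀ l → l < suc n → sgn l * ((+ n + + l) * L n l * L l 0) - sgn l * (L n l * L (suc l) 0) ≡ + 0
  vanish zero    _ = trans (cong (λ x → + 1 * (x * + 1) - + 1 * (L n 0 * + 0)) ([n+0]*L[n,0]≡0 n))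
                           (zeroes (+ 1) (+ 0) (L n 0))
  vanish (suc l) _ = zeroes (sgn (suc l)) ((+ n + + suc l) * L n (suc l)) (L n (suc l))

-- The recurrence of L in the column index, applied to L(l+1, j+1).
alternatingLahSum-suc-suc : ∀ n j → alternatingLahSum (suc n) (suc j)
  ≡ (+ n - + suc j) * alternatingLahSum n (suc j) - alternatingLahSum n j
alternatingLahSum-suc-suc n j = begin
  alternatingLahSum (suc n) (suc j)
    ≡⟨ alternatingLahSum-suc n (suc j) ⟩
  ∑[ l < suc n ] (sgn l * ((+ n + + l) * L n l * L l (suc j)) - sgn l * (L n l * L (suc l) (suc j)))
    ≡⟨ ∑-cong (suc n) (λ l _ → column-recurrence l) ⟩
  ∑[ l < suc n ] (c * u l + - + 1 * v l)
    ≡⟨ ∑-+ (suc n) (λ l → c * u l) (λ l → - + 1 * v l) ⟩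
  ∑[ l < suc n ] (c * u l) + ∑[ l < suc n ] (- + 1 * v l)
    ≡⟨ cong₂ _+_ (∑-*ˡ (suc n) c u) (∑-*ˡ (suc n) (- + 1) v) ⟩
  c * alternatingLahSum n (suc j) + - + 1 * alternatingLahSum n j
    ≡⟨ cong (_+_ (c * alternatingLahSum n (suc j))) (ℤₚ.-1*i≡-i (alternatingLahSum n j)) ⟩
  c * alternatingLahSum n (suc j) - alternatingLahSum n j ∎
  where
  open ≡-Reasoning
  c : ℤ
  c = + n - + suc j
  u v : ℕ → ℤ
  u l = sgn l * (L n l * L l (suc j))
  v l = sgn l * (L n l * L l j)
  column-recurrence : ∀ l → sgn l * ((+ n + + l) * L n l * L l (suc j)) - sgn l * (L n l * L (suc l) (suc j))
                            ≡ c * u l + - + 1 * v l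
  column-recurrence l = trans (cong (λ x → sgn l * ((+ n + + l) * L n l * L l (suc j)) - sgn l * (L n l * x))
                                    (L-suc-suc l j))
                              (collect (sgn l) (+ n) (+ l) (+ suc j) (L n l) (L l (suc j)) (L l j))
    where
    collect : ∀ s a l k x y z → s * ((a + l) * x * y) - s * (x * ((l + k) * y + z))
                              ≡ (a - k) * (s * (x * y)) + - + 1 * (s * (x * z))
    collect = solve-∀

alternatingLahSum≡sgn*δ : ∀ n k → alternatingLahSum n k ≡ sgn k * δ n k
alternatingLahSum≡sgn*δ zero    zero    = refl
alternatingLahSum≡sgn*δ zero    (suc k) = sym (ℤₚ.*-zeroʳ (sgn (suc k)))
alternatingLahSum≡sgn*δ (suc n) zero    = alternatingLahSum-suc-zero n
alternatingLahSum≡sgn*δ (suc n) (suc j) = begin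
  alternatingLahSum (suc n) (suc j)
    ≡⟨ alternatingLahSum-suc-suc n j ⟩
  c * alternatingLahSum n (suc j) - alternatingLahSum n j
    ≡⟨ cong₂ (λ x y → c * x - y) (alternatingLahSum≡sgn*δ n (suc j)) (alternatingLahSum≡sgn*δ n j) ⟩
  c * (sgn (suc j) * δ n (suc j)) - sgn j * δ n j
    ≡⟨ rearrange c (sgn (suc j)) (δ n (suc j)) (sgn j) (δ n j) ⟩
  sgn (suc j) * (c * δ n (suc j)) + - sgn j * δ n j
    ≡⟨ cong (λ x → sgn (suc j) * x + - sgn j * δ n j) ([a-b]*δ≡0 n (suc j)) ⟩
  sgn (suc j) * + 0 + - sgn j * δ n j
    ≡⟨ drop (sgn (suc j)) (- sgn j * δ n j) ⟩
  - sgn j * δ n j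
    ≡⟨ cong (_* δ n j) (sgn-suc j) ⟨
  sgn (suc j) * δ (suc n) (suc j) ∎
  where
  open ≡-Reasoning
  c : ℤ
  c = + n - + suc j
  rearrange : ∀ c s d t e → c * (s * d) - t * e ≡ s * (c * d) + - t * e
  rearrange = solve-∀
  drop : ∀ s x → s * + 0 + x ≡ x
  drop = solve-∀

S-above : ∀ {n k} → n < k → S n k ≡ + 0
S-above {k = k} n<k = trans (cong (sgn k *_) (L-above n<k)) (ℤₚ.*-zeroʳ (sgn k))

S*S≡δ : ∀ {N n} k → n ≤ N → ∑[ l < suc N ] (S n l * S l k) ≡ δ n k
S*S≡δ {N} {n} k n≤N = begin
  ∑[ l < suc N ] (S n l * S l k)
    ≡⟨ ∑-truncate (λ l → S n l * S l k) (s≤s n≤N) (λ l n<l _ → cong (_* S l k) (S-above n<l)) ⟩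
  ∑[ l < suc n ] (S n l * S l k)
    ≡⟨ ∑-cong (suc n) (λ l _ → regroup (sgn l) (L n l) (sgn k) (L l k)) ⟩
  ∑[ l < suc n ] (sgn k * (sgn l * (L n l * L l k)))
    ≡⟨ ∑-*ˡ (suc n) (sgn k) (λ l → sgn l * (L n l * L l k)) ⟩
  sgn k * alternatingLahSum n k
    ≡⟨ cong (sgn k *_) (alternatingLahSum≡sgn*δ n k) ⟩
  sgn k * (sgn k * δ n k)
    ≡⟨ ℤₚ.*-assoc (sgn k) (sgn k) (δ n k) ⟨
  sgn k * sgn k * δ n k
    ≡⟨ cong (_* δ n k) (sgn*sgn≡1 k) ⟩
  + 1 * δ n k
    ≡⟨ ℤₚ.*-identityˡ (δ n k) ⟩
  δ n k ∎
  where
  open ≡-Reasoning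
  regroup : ∀ s x t y → (s * x) * (t * y) ≡ t * (s * (x * y))
  regroup = solve-∀

S*δ≡S : ∀ {N n} k → n ≤ N → ∑[ l < suc N ] (S n l * δ l k) ≡ S n k
S*δ≡S {N} {n} k n≤N with k ≤? N
... | yes k≤N = begin
  ∑[ l < suc N ] (S n l * δ l k) ≡⟨ ∑-single k (λ l → S n l * δ l k) (s≤s k≤N) off-diagonal ⟩
  S n k * δ k k                  ≡⟨ cong (S n k *_) (δ-refl k) ⟩
  S n k * + 1                    ≡⟨ ℤₚ.*-identityʳ (S n k) ⟩
  S n k                          ∎
  where
  open ≡-Reasoning
  off-diagonal : ∀ l → l < suc N → l ≢ k → S n l * δ l k ≡ + 0
  off-diagonal l _ l≢k = trans (cong (S n l *_) (δ-≢ l≢k)) (ℤₚ.*-zeroʳ (S n l))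
... | no k≰N = begin
  ∑[ l < suc N ] (S n l * δ l k) ≡⟨ ∑-zero (suc N) (λ l → S n l * δ l k) off-diagonal ⟩
  + 0                            ≡⟨ S-above (ℕₚ.≤-<-trans n≤N (ℕₚ.≰⇒> k≰N)) ⟨
  S n k                          ∎
  where
  open ≡-Reasoning
  off-diagonal : ∀ l → l < suc N → S n l * δ l k ≡ + 0
  off-diagonal l (s≤s l≤N) = trans (cong (S n l *_) (δ-≢ λ l≡k → k≰N (subst (_≤ N) l≡k l≤N)))
                                   (ℤₚ.*-zeroʳ (S n l))

-- The p-th matrix power of S (see S*S^≡S^[1+p]), which depends only on the parity of p as S*S = δ.
S^ : ℕ → ℕ → ℕ → ℤ
S^ zero          = δ
S^ (suc zero)    = S
S^ (suc (suc p)) = S^ p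

S*S^≡S^[1+p] : ∀ p {N n} k → n ≤ N → ∑[ l < suc N ] (S n l * S^ p l k) ≡ S^ (suc p) n k
S*S^≡S^[1+p] zero          = S*δ≡S
S*S^≡S^[1+p] (suc zero)    = S*S≡δ
S*S^≡S^[1+p] (suc (suc p)) = S*S^≡S^[1+p] p

-- lhs m n k is chainSum (m ∸ 1) n n k; separating the range bound N from the starting row lets the
-- induction start from any row below N.
chainSum : ℕ → ℕ → ℕ → ℕ → ℤ
chainSum j N n k = sumℤ (map (λ ls → sgn (sumℕ ls ℕ.+ k) * + chainProd n ls k) (tuples j N))

chainSum-suc : ∀ j N n k → chainSum (suc j) N n k ≡ ∑[ l < suc N ] (S n l * chainSum j N l k)
chainSum-suc j N n k = trans (sumℤ-map-concatMap-upTo (suc N) term (λ _ → tuples j N))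
                             (∑-cong (suc N) λ l _ → factor-first l)
  where
  term : ∀ {i} → Vec ℕ i → ℤ
  term ls = sgn (sumℕ ls ℕ.+ k) * + chainProd n ls k
  split : ∀ l (ls : Vec ℕ j) → term (l ∷ ls) ≡ S n l * (sgn (sumℕ ls ℕ.+ k) * + chainProd l ls k)
  split l ls = begin
    sgn (l ℕ.+ sumℕ ls ℕ.+ k) * + (Lah n l ℕ.* chainProd l ls k)
      ≡⟨ cong₂ _*_ (trans (cong sgn (ℕₚ.+-assoc l (sumℕ ls) k)) (sgn-+ l (sumℕ ls ℕ.+ k)))
                   (ℤₚ.pos-* (Lah n l) (chainProd l ls k)) ⟩
    sgn l * sgn (sumℕ ls ℕ.+ k) * (L n l * + chainProd l ls k)
      ≡⟨ swap (sgn l) (sgn (sumℕ ls ℕ.+ k)) (L n l) (+ chainProd l ls k) ⟩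
    S n l * (sgn (sumℕ ls ℕ.+ k) * + chainProd l ls k) ∎
    where
    open ≡-Reasoning
    swap : ∀ s t x y → (s * t) * (x * y) ≡ (s * x) * (t * y)
    swap = solve-∀
  factor-first : ∀ l → sumℤ (map (λ ls → term (l ∷ ls)) (tuples j N)) ≡ S n l * chainSum j N l k
  factor-first l = trans (cong sumℤ (List.map-cong (split l) (tuples j N)))
                         (sumℤ-map-*ˡ (S n l) _ (tuples j N))

chainSum≡S^ : ∀ j {N n} k → n ≤ N → chainSum j N n k ≡ S^ (suc j) n k
chainSum≡S^ zero    k n≤N = ℤₚ.+-identityʳ _
chainSum≡S^ (suc j) {N} {n} k n≤N = begin
  chainSum (suc j) N n k
    ≡⟨ chainSum-suc j N n k ⟩
  ∑[ l < suc N ] (S n l * chainSum j N l k)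
    ≡⟨ ∑-cong (suc N) (λ { l (s≤s l≤N) → cong (S n l *_) (chainSum≡S^ j k l≤N) }) ⟩
  ∑[ l < suc N ] (S n l * S^ (suc j) l k)
    ≡⟨ S*S^≡S^[1+p] (suc j) k n≤N ⟩
  S^ (suc (suc j)) n k ∎
  where open ≡-Reasoning

alternatingBinomialPartialSum : ∀ s j → ∑[ a < suc j ] (sgn a * + (suc s C a)) ≡ sgn j * + (s C j)
alternatingBinomialPartialSum s zero    = refl
alternatingBinomialPartialSum s (suc j) = begin
  ∑[ a < suc (suc j) ] f a
    ≡⟨ ∑-last (suc j) f ⟩
  ∑[ a < suc j ] f a + f (suc j)
    ≡⟨ cong (_+ f (suc j)) (alternatingBinomialPartialSum s j) ⟩
  sgn j * + (s C j) + sgn (suc j) * + (suc s C suc j)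
    ≡⟨ cong (λ x → sgn j * + (s C j) + sgn (suc j) * + x) (nCk+nC[k+1]≡[n+1]C[k+1] s j) ⟨
  sgn j * + (s C j) + sgn (suc j) * + (s C j ℕ.+ s C suc j)
    ≡⟨ cong₂ (λ x y → sgn j * + (s C j) + x * y) (sgn-suc j) (ℤₚ.pos-+ (s C j) (s C suc j)) ⟩
  sgn j * + (s C j) + - sgn j * (+ (s C j) + + (s C suc j))
    ≡⟨ telescope (sgn j) (+ (s C j)) (+ (s C suc j)) ⟩
  - sgn j * + (s C suc j)
    ≡⟨ cong (_* + (s C suc j)) (sgn-suc j) ⟨
  sgn (suc j) * + (s C suc j) ∎
  where
  open ≡-Reasoning
  f : ℕ → ℤ
  f a = sgn a * + (suc s C a)
  telescope : ∀ g x y → g * x + - g * (x + y) ≡ - g * y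
  telescope = solve-∀

alternatingBinomialSum : ∀ s → ∑[ a < suc s ] (sgn a * + (s C a)) ≡ δ s 0
alternatingBinomialSum zero    = refl
alternatingBinomialSum (suc s) = begin
  ∑[ a < suc (suc s) ] (sgn a * + (suc s C a)) ≡⟨ alternatingBinomialPartialSum s (suc s) ⟩
  sgn (suc s) * + (s C suc s)                  ≡⟨ cong (λ x → sgn (suc s) * + x) (k>n⇒nCk≡0 (ℕₚ.n<1+n s)) ⟩
  sgn (suc s) * + 0                            ≡⟨ ℤₚ.*-zeroʳ (sgn (suc s)) ⟩
  + 0                                          ∎
  where open ≡-Reasoning

sumℤ-compositions-cong : ∀ m s {f g : Vec ℕ m → ℤ} → (∀ ks → sumℕ ks ≡ s → f ks ≡ g ks) →
                         sumℤ (map f (compositions m s)) ≡ sumℤ (map g (compositions m s))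
sumℤ-compositions-cong zero    zero    f≡g = cong (_+ + 0) (f≡g [] refl)
sumℤ-compositions-cong zero    (suc s) f≡g = refl
sumℤ-compositions-cong (suc m) s {f} {g} f≡g = begin
  sumℤ (map f (compositions (suc m) s))
    ≡⟨ sumℤ-map-concatMap-upTo (suc s) f (λ a → compositions m (s ∸ a)) ⟩
  ∑[ a < suc s ] sumℤ (map (λ ks → f (a ∷ ks)) (compositions m (s ∸ a)))
    ≡⟨ ∑-cong (suc s) (λ a a<1+s → sumℤ-compositions-cong m (s ∸ a) λ ks Σks≡s∸a →
         f≡g (a ∷ ks) (trans (cong (a ℕ.+_) Σks≡s∸a) (ℕₚ.m+[n∸m]≡n (ℕₚ.≤-pred a<1+s)))) ⟩
  ∑[ a < suc s ] sumℤ (map (λ ks → g (a ∷ ks)) (compositions m (s ∸ a)))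
    ≡⟨ sumℤ-map-concatMap-upTo (suc s) g (λ a → compositions m (s ∸ a)) ⟨
  sumℤ (map g (compositions (suc m) s)) ∎
  where open ≡-Reasoning

signedMultinomialSum : ℕ → ℕ → ℕ → ℤ
signedMultinomialSum n m s = sumℤ (map (λ ks → sgn (compExp n ks) * + multinomialC ks) (compositions m s))

signedMultinomialSum-one : ∀ n s → signedMultinomialSum n 1 s ≡ + 1
signedMultinomialSum-one n s = begin
  signedMultinomialSum n 1 s
    ≡⟨ sumℤ-map-concatMap-upTo (suc s) term (λ a → compositions 0 (s ∸ a)) ⟩
  ∑[ a < suc s ] sumℤ (map (λ ks → term (a ∷ ks)) (compositions 0 (s ∸ a)))
    ≡⟨ ∑-single s _ ℕₚ.≤-refl (λ a a<1+s a≢s → no-composition a (ℕₚ.≤-pred a<1+s) a≢s) ⟩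
  sumℤ (map (λ ks → term (s ∷ ks)) (compositions 0 (s ∸ s)))
    ≡⟨ cong (λ t → sumℤ (map (λ ks → term (s ∷ ks)) (compositions 0 t))) (ℕₚ.n∸n≡0 s) ⟩
  + 1 * + (((s ℕ.+ 0) C s) ℕ.* 1) + + 0
    ≡⟨ cong (λ t → + 1 * + ((t C s) ℕ.* 1) + + 0) (ℕₚ.+-identityʳ s) ⟩
  + 1 * + ((s C s) ℕ.* 1) + + 0
    ≡⟨ cong (λ x → + 1 * + (x ℕ.* 1) + + 0) (nCn≡1 s) ⟩
  + 1 ∎
  where
  open ≡-Reasoning
  term : ∀ {i} → Vec ℕ i → ℤ
  term ks = sgn (compExp n ks) * + multinomialC ks
  no-composition : ∀ a → a ≤ s → a ≢ s → sumℤ (map (λ ks → term (a ∷ ks)) (compositions 0 (s ∸ a))) ≡ + 0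
  no-composition a a≤s a≢s with s ∸ a in s∸a≡
  ... | zero  = ⊥-elim (a≢s (ℕₚ.≤-antisym a≤s (ℕₚ.m∸n≡0⇒m≤n s∸a≡)))
  ... | suc _ = refl

-- compExp ignores the first part, so splitting off the first part a changes the exponent by
-- n ∸ (s ∸ a) only when at least one further part remains.
signedMultinomialSum-suc-suc : ∀ n m s → signedMultinomialSum n (suc (suc m)) s
  ≡ ∑[ a < suc s ] (sgn (n ∸ (s ∸ a)) * + (s C a) * signedMultinomialSum n (suc m) (s ∸ a))
signedMultinomialSum-suc-suc n m s =
  trans (sumℤ-map-concatMap-upTo (suc s) term (λ a → compositions (suc m) (s ∸ a)))
        (∑-cong (suc s) λ a a<1+s →
           trans (sumℤ-compositions-cong (suc m) (s ∸ a) (split-first a (ℕₚ.≤-pred a<1+s)))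
                 (sumℤ-map-*ˡ (sgn (n ∸ (s ∸ a)) * + (s C a)) term (compositions (suc m) (s ∸ a))))
  where
  term : ∀ {i} → Vec ℕ i → ℤ
  term ks = sgn (compExp n ks) * + multinomialC ks
  split-first : ∀ a → a ≤ s → (ks : Vec ℕ (suc m)) → sumℕ ks ≡ s ∸ a →
                term (a ∷ ks) ≡ sgn (n ∸ (s ∸ a)) * + (s C a) * term ks
  split-first a a≤s ks@(b ∷ ks′) Σks≡s∸a = begin
    sgn (n ∸ sumℕ ks ℕ.+ suffixExp n ks′) * + (((a ℕ.+ sumℕ ks) C a) ℕ.* multinomialC ks)
      ≡⟨ cong (λ t → sgn (n ∸ t ℕ.+ suffixExp n ks′) * + (((a ℕ.+ t) C a) ℕ.* multinomialC ks)) Σks≡s∸a ⟩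
    sgn (n ∸ (s ∸ a) ℕ.+ suffixExp n ks′) * + (((a ℕ.+ (s ∸ a)) C a) ℕ.* multinomialC ks)
      ≡⟨ cong (λ t → sgn (n ∸ (s ∸ a) ℕ.+ suffixExp n ks′) * + ((t C a) ℕ.* multinomialC ks)) (ℕₚ.m+[n∸m]≡n a≤s) ⟩
    sgn (n ∸ (s ∸ a) ℕ.+ suffixExp n ks′) * + ((s C a) ℕ.* multinomialC ks)
      ≡⟨ cong₂ _*_ (sgn-+ (n ∸ (s ∸ a)) (suffixExp n ks′)) (ℤₚ.pos-* (s C a) (multinomialC ks)) ⟩
    sgn (n ∸ (s ∸ a)) * sgn (suffixExp n ks′) * (+ (s C a) * + multinomialC ks)
      ≡⟨ swap (sgn (n ∸ (s ∸ a))) (sgn (suffixExp n ks′)) (+ (s C a)) (+ multinomialC ks) ⟩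
    sgn (n ∸ (s ∸ a)) * + (s C a) * term ks ∎
    where
    open ≡-Reasoning
    swap : ∀ p q c x → (p * q) * (c * x) ≡ (p * c) * (q * x)
    swap = solve-∀

-- The value of  signedMultinomialSum n m s  for m ≥ 1 parts; the clause for m = 0 only serves as the
-- even case of the recursion.
parityValue : ℕ → ℕ → ℕ → ℤ
parityValue n zero          s = sgn n * δ s 0
parityValue n (suc zero)    s = + 1
parityValue n (suc (suc m)) s = parityValue n m s

binomialTransform-parityValue : ∀ m {n s} → s ≤ n →
  ∑[ a < suc s ] (sgn (n ∸ (s ∸ a)) * + (s C a) * parityValue n (suc m) (s ∸ a)) ≡ parityValue n (suc (suc m)) s
binomialTransform-parityValue zero {n} {s} s≤n = begin
  ∑[ a < suc s ] (sgn (n ∸ (s ∸ a)) * + (s C a) * + 1)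
    ≡⟨ ∑-cong (suc s) (λ a a<1+s → split-sign a (ℕₚ.≤-pred a<1+s)) ⟩
  ∑[ a < suc s ] (sgn n * sgn s * (sgn a * + (s C a)))
    ≡⟨ ∑-*ˡ (suc s) (sgn n * sgn s) (λ a → sgn a * + (s C a)) ⟩
  sgn n * sgn s * ∑[ a < suc s ] (sgn a * + (s C a))
    ≡⟨ cong (sgn n * sgn s *_) (alternatingBinomialSum s) ⟩
  sgn n * sgn s * δ s 0
    ≡⟨ ℤₚ.*-assoc (sgn n) (sgn s) (δ s 0) ⟩
  sgn n * (sgn s * δ s 0)
    ≡⟨ cong (sgn n *_) (sgn*δ-0 s) ⟩
  sgn n * δ s 0 ∎
  where
  open ≡-Reasoning
  split-sign : ∀ a → a ≤ s → sgn (n ∸ (s ∸ a)) * + (s C a) * + 1 ≡ sgn n * sgn s * (sgn a * + (s C a))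
  split-sign a a≤s = trans (cong (λ x → x * + (s C a) * + 1)
                                 (trans (sgn-∸ (ℕₚ.≤-trans (ℕₚ.m∸n≤m s a) s≤n)) (cong (sgn n *_) (sgn-∸ a≤s))))
                           (regroup (sgn n) (sgn s) (sgn a) (+ (s C a)))
    where
    regroup : ∀ p q r c → p * (q * r) * c * + 1 ≡ p * q * (r * c)
    regroup = solve-∀
binomialTransform-parityValue (suc zero) {n} {s} s≤n = begin
  ∑[ a < suc s ] f a
    ≡⟨ ∑-single s f ℕₚ.≤-refl (λ a a<1+s a≢s → off-diagonal a (ℕₚ.≤-pred a<1+s) a≢s) ⟩
  sgn (n ∸ (s ∸ s)) * + (s C s) * (sgn n * δ (s ∸ s) 0)
    ≡⟨ cong (λ t → sgn (n ∸ t) * + (s C s) * (sgn n * δ t 0)) (ℕₚ.n∸n≡0 s) ⟩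
  sgn n * + (s C s) * (sgn n * + 1)
    ≡⟨ cong (λ x → sgn n * + x * (sgn n * + 1)) (nCn≡1 s) ⟩
  sgn n * + 1 * (sgn n * + 1)
    ≡⟨ square (sgn n) ⟩
  sgn n * sgn n
    ≡⟨ sgn*sgn≡1 n ⟩
  + 1 ∎
  where
  open ≡-Reasoning
  f : ℕ → ℤ
  f a = sgn (n ∸ (s ∸ a)) * + (s C a) * (sgn n * δ (s ∸ a) 0)
  off-diagonal : ∀ a → a ≤ s → a ≢ s → f a ≡ + 0
  off-diagonal a a≤s a≢s = trans (cong (λ x → sgn (n ∸ (s ∸ a)) * + (s C a) * (sgn n * x)) (δ[n∸k,0]≡0 a≤s a≢s))
                                 (vanish (sgn (n ∸ (s ∸ a)) * + (s C a)) (sgn n))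
    where
    vanish : ∀ c p → c * (p * + 0) ≡ + 0
    vanish = solve-∀
  square : ∀ p → p * + 1 * (p * + 1) ≡ p * p
  square = solve-∀
binomialTransform-parityValue (suc (suc m)) = binomialTransform-parityValue m

signedMultinomialSum≡parityValue : ∀ m {n s} → s ≤ n → signedMultinomialSum n (suc m) s ≡ parityValue n (suc m) s
signedMultinomialSum≡parityValue zero    {n} {s} _   = signedMultinomialSum-one n s
signedMultinomialSum≡parityValue (suc m) {n} {s} s≤n = begin
  signedMultinomialSum n (suc (suc m)) s
    ≡⟨ signedMultinomialSum-suc-suc n m s ⟩
  ∑[ a < suc s ] (sgn (n ∸ (s ∸ a)) * + (s C a) * signedMultinomialSum n (suc m) (s ∸ a))
    ≡⟨ ∑-cong (suc s) (λ a _ → cong (sgn (n ∸ (s ∸ a)) * + (s C a) *_)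
                                    (signedMultinomialSum≡parityValue m (ℕₚ.≤-trans (ℕₚ.m∸n≤m s a) s≤n))) ⟩
  ∑[ a < suc s ] (sgn (n ∸ (s ∸ a)) * + (s C a) * parityValue n (suc m) (s ∸ a))
    ≡⟨ binomialTransform-parityValue m s≤n ⟩
  parityValue n (suc (suc m)) s ∎
  where open ≡-Reasoning

rhs≡S*signedMultinomialSum : ∀ m {n k} → k ≤ n →
  rhs m (suc n) (suc k) ≡ S (suc n) (suc k) * signedMultinomialSum (suc n) m (n ∸ k)
rhs≡S*signedMultinomialSum m {n} {k} k≤n =
  trans (sumℤ-compositions-cong m (n ∸ k) factor-S)
        (sumℤ-map-*ˡ (S (suc n) (suc k)) (λ ks → sgn (compExp (suc n) ks) * + multinomialC ks) (compositions m (n ∸ k)))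
  where
  instance _ = suc k !≢0
  Q : ℕ
  Q = suc n ! ℕ./ suc k !
  Q*multinomial≡Lah*multinomialC : ∀ (ks : Vec ℕ m) → sumℕ ks ≡ n ∸ k →
    Q ℕ.* multinomial (suc n) ks (suc k) ≡ Lah (suc n) (suc k) ℕ.* multinomialC ks
  Q*multinomial≡Lah*multinomialC ks Σks≡n∸k = begin
    Q ℕ.* multinomial (suc n) ks (suc k)   ≡⟨ cong (Q ℕ.*_) (multinomial≡nCk*multinomialC n k ks k≤n Σks≡n∸k) ⟩
    Q ℕ.* ((n C k) ℕ.* multinomialC ks)    ≡⟨ ℕₚ.*-assoc Q (n C k) (multinomialC ks) ⟨
    Q ℕ.* (n C k) ℕ.* multinomialC ks      ≡⟨ cong (ℕ._* multinomialC ks) (ℕₚ.*-comm Q (n C k)) ⟩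
    (n C k) ℕ.* Q ℕ.* multinomialC ks      ≡⟨ cong (ℕ._* multinomialC ks) (Lah≡nCk*[n+1]!/[k+1]! k≤n) ⟨
    Lah (suc n) (suc k) ℕ.* multinomialC ks ∎
    where open ≡-Reasoning
  factor-S : ∀ (ks : Vec ℕ m) → sumℕ ks ≡ n ∸ k →
    sgn (compExp (suc n) ks ℕ.+ suc k) * + (Q ℕ.* multinomial (suc n) ks (suc k))
      ≡ S (suc n) (suc k) * (sgn (compExp (suc n) ks) * + multinomialC ks)
  factor-S ks Σks≡n∸k = begin
    sgn (e ℕ.+ suc k) * + (Q ℕ.* multinomial (suc n) ks (suc k))
      ≡⟨ cong₂ _*_ (sgn-+ e (suc k)) (cong +_ (Q*multinomial≡Lah*multinomialC ks Σks≡n∸k)) ⟩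
    sgn e * sgn (suc k) * + (Lah (suc n) (suc k) ℕ.* multinomialC ks)
      ≡⟨ cong (sgn e * sgn (suc k) *_) (ℤₚ.pos-* (Lah (suc n) (suc k)) (multinomialC ks)) ⟩
    sgn e * sgn (suc k) * (L (suc n) (suc k) * + multinomialC ks)
      ≡⟨ swap (sgn e) (sgn (suc k)) (L (suc n) (suc k)) (+ multinomialC ks) ⟩
    S (suc n) (suc k) * (sgn e * + multinomialC ks) ∎
    where
    open ≡-Reasoning
    e : ℕ
    e = compExp (suc n) ks
    swap : ∀ p q x y → p * q * (x * y) ≡ q * x * (p * y)
    swap = solve-∀

S^≡S*parityValue : ∀ m {n k} → k ≤ n →
  S^ (suc m) (suc n) (suc k) ≡ S (suc n) (suc k) * parityValue (suc n) (suc m) (n ∸ k)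
S^≡S*parityValue zero          k≤n = sym (ℤₚ.*-identityʳ _)
S^≡S*parityValue (suc zero) {n} {k} k≤n with k ℕ.≟ n
... | yes refl = begin
  δ n n                                             ≡⟨ δ-refl n ⟩
  + 1                                               ≡⟨ sgn*sgn≡1 (suc n) ⟨
  sgn (suc n) * sgn (suc n)                         ≡⟨ square (sgn (suc n)) ⟨
  sgn (suc n) * + 1 * (sgn (suc n) * + 1)           ≡⟨ cong (λ x → sgn (suc n) * + x * (sgn (suc n) * + 1)) (Lah-diag (suc n)) ⟨
  S (suc n) (suc n) * (sgn (suc n) * + 1)           ≡⟨ cong (λ t → S (suc n) (suc n) * (sgn (suc n) * δ t 0)) (ℕₚ.n∸n≡0 n) ⟨
  S (suc n) (suc n) * (sgn (suc n) * δ (n ∸ n) 0)   ∎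
  where
  open ≡-Reasoning
  square : ∀ p → p * + 1 * (p * + 1) ≡ p * p
  square = solve-∀
... | no k≢n = begin
  δ n k                                             ≡⟨ δ-≢ (k≢n ∘ sym) ⟩
  + 0                                               ≡⟨ ℤₚ.*-zeroʳ (S (suc n) (suc k)) ⟨
  S (suc n) (suc k) * + 0                           ≡⟨ cong (S (suc n) (suc k) *_) (ℤₚ.*-zeroʳ (sgn (suc n))) ⟨
  S (suc n) (suc k) * (sgn (suc n) * + 0)           ≡⟨ cong (λ x → S (suc n) (suc k) * (sgn (suc n) * x)) (δ[n∸k,0]≡0 k≤n k≢n) ⟨
  S (suc n) (suc k) * (sgn (suc n) * δ (n ∸ k) 0)   ∎
  where open ≡-Reasoning
S^≡S*parityValue (suc (suc m)) = S^≡S*parityValue m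

theorem2 : (m n k : ℕ) → 1 ≤ m → 1 ≤ n → 1 ≤ k → k ≤ n → lhs m n k ≡ rhs m n k
theorem2 (suc j) (suc n) (suc k) _ _ _ (s≤s k≤n) = begin
  lhs (suc j) (suc n) (suc k)                                          ≡⟨ chainSum≡S^ j (suc k) ℕₚ.≤-refl ⟩
  S^ (suc j) (suc n) (suc k)                                           ≡⟨ S^≡S*parityValue j k≤n ⟩
  S (suc n) (suc k) * parityValue (suc n) (suc j) (n ∸ k)              ≡⟨ cong (S (suc n) (suc k) *_) (signedMultinomialSum≡parityValue j n∸k≤1+n) ⟨
  S (suc n) (suc k) * signedMultinomialSum (suc n) (suc j) (n ∸ k)     ≡⟨ rhs≡S*signedMultinomialSum (suc j) k≤n ⟨
  rhs (suc j) (suc n) (suc k)                                          ∎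
  where
  open ≡-Reasoning
  n∸k≤1+n : n ∸ k ≤ suc n
  n∸k≤1+n = ℕₚ.≤-trans (ℕₚ.m∸n≤m n k) (ℕₚ.n≤1+n n)
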